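{- Let $n$ be a composite integer which is not the square of a prime, with prime power factorization $n=p_1^{\alpha_1}\cdots p_k^{\alpha_k}$ (distinct primes $p_i$). If $n$ is not a product of two distinct primes, then $Y=\{n/p_1,n/p_2,\dots,n/p_k\}$ is a dominating set of $\Upsilon_n$ of minimum size. Consequently the domination number satisfies $\gamma(\Upsilon_n)=1$ if $n=p_1p_2$ with $p_1\ne p_2$, and $\gamma(\Upsilon_n)=k$ otherwise.
   Context: For an integer $n>1$, a proper divisor of $n$ is an integer $d$ with $1<d<n$ and $d\mid n$. The proper divisor graph $\Upsilon_n$ is the simple graph whose vertices are the proper divisors of $n$, two distinct vertices $u,v$ being adjacent iff $n\mid uv$. A dominating set is a set $X$ of vertices such that every vertex outside $X$ is adjacent to some vertex of $X$. -}

module Defs where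

open import Data.Nat using (ℕ; _*_; _<_; _≤_)
open import Data.Nat.Divisibility using (_∣_)
open import Data.Nat.Primality using (Prime)
open import Data.Product using (_×_; ∃-syntax)
open import Data.List using (List; length)
open import Data.List.Relation.Unary.All using (All)
open import Data.List.Relation.Unary.Unique.Propositional using (Unique)
open import Data.List.Membership.Propositional using (_∈_; _∉_)
open import Relation.Binary.PropositionalEquality using (_≡_; _≢_)

-- d is a proper divisor of n : 1 < d < n and d ∣ n (vertices of Υ_n)
ProperDivisor : ℕ → ℕ → Set
ProperDivisor n d = 1 < d × d < n × d ∣ n

-- adjacency in Υ_n : distinct vertices u, v with n ∣ u v
Adj : ℕ → ℕ → ℕ → Set
Adj n u v = u ≢ v × n ∣ u * v

VertexSet : ℕ → List ℕ → Set
VertexSet n X = Unique X × All (ProperDivisor n) X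

Dominating : ℕ → List ℕ → Set
Dominating n X =
  VertexSet n X ×
  (∀ v → ProperDivisor n v → v ∉ X → ∃[ u ] (u ∈ X × Adj n u v))

MinDominating : ℕ → List ℕ → Set
MinDominating n X = Dominating n X × (∀ Z → Dominating n Z → length X ≤ length Z)

DominationNumber : ℕ → ℕ → Set
DominationNumber n g =
  (∃[ X ] (Dominating n X × length X ≡ g)) ×
  (∀ Z → Dominating n Z → g ≤ length Z)

PrimeSquare : ℕ → Set
PrimeSquare n = ∃[ p ] (Prime p × n ≡ p * p)

TwoDistinctPrimes : ℕ → Set
TwoDistinctPrimes n = ∃[ p ] ∃[ q ] (Prime p × Prime q × p ≢ q × n ≡ p * q)

-- Every proper divisor v has a prime factor p, and then n / p is adjacent to v (or equal to it),
-- so Y dominates. Conversely, for each prime p ∣ n a dominating set contains p or a neighbour u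
-- of p; since u is a proper divisor with n ∣ u p, necessarily u p = n. Unless n = p q with
-- p ≠ q, the element so attached to p determines p, whence every dominating set has at least
-- k ≥ |Y| elements. For n = p q every proper divisor other than p is a multiple of q, so {p}
-- dominates.

module Submission where

open import Defs
open import Data.Nat using (ℕ; zero; suc; _*_; _<_; _≤_; z≤n; s≤s; NonZero; _≟_; ≢-nonZero; ≢-nonZero⁻¹; nonTrivial⇒n>1)
open import Data.Nat.Properties
open import Data.Nat.Divisibility
open import Data.Nat.Coprimality using (Coprime; coprime-divisor)
import Data.Nat.Coprimality as Coprime
open import Data.Nat.Primality
open import Data.Nat.Primality.Factorisation using (factorise)
open import Data.Product using (_×_; ∃-syntax; _,_)
open import Data.Sum using (_⊎_; inj₁; inj₂)
open import Data.List using (List; length; []; _∷_; filter)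
open import Data.Nat.ListAction using (product)
open import Data.List.Properties using (filter-notAll)
open import Data.List.Relation.Unary.All as All using (All; []; _∷_)
open import Data.List.Relation.Unary.Any using (here; there)
import Data.List.Relation.Unary.Any as Any
open import Data.List.Relation.Unary.Unique.Propositional using (Unique)
open import Data.List.Relation.Unary.AllPairs using ([]; _∷_)
open import Data.List.Membership.Propositional using (_∈_; _∉_)
open import Data.List.Membership.Propositional.Properties using (∈-filter⁺)
open import Data.List.Membership.DecPropositional _≟_ using (_∈?_)
open import Function.Bundles using (_⇔_; Equivalence)
open import Relation.Binary.Definitions using (DecidableEquality)
open import Relation.Nullary using (¬_; Dec; yes; no; ¬?; contradiction)
open import Relation.Binary.PropositionalEquality

module _ {a b r} {A : Set a} {B : Set b} (_≟ᴮ_ : DecidableEquality B) (R : A → B → Set r) where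

  length-≤-by-injective-relation : ∀ {xs zs} → Unique xs →
    (∀ {x} → x ∈ xs → ∃[ z ] (z ∈ zs × R x z)) →
    (∀ {x x′ z} → R x z → R x′ z → x ≡ x′) →
    length xs ≤ length zs
  length-≤-by-injective-relation {[]} _ _ _ = z≤n
  length-≤-by-injective-relation {x ∷ xs} {zs} (x∉xs ∷ unique[xs]) cover injective
    with z , z∈zs , Rxz ← cover (here refl) = ≤-trans (s≤s ih) shrink
    where
    ≢z? : ∀ w → Dec (w ≢ z)
    ≢z? w = ¬? (w ≟ᴮ z)
    zs′ : List B
    zs′ = filter ≢z? zs
    shrink : length zs′ < length zs
    shrink = filter-notAll ≢z? zs (Any.map (λ { refl w≢w → w≢w refl }) z∈zs)
    cover′ : ∀ {x′} → x′ ∈ xs → ∃[ z′ ] (z′ ∈ zs′ × R x′ z′)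
    cover′ x′∈xs with z′ , z′∈zs , Rx′z′ ← cover (there x′∈xs) =
      z′ , ∈-filter⁺ ≢z? z′∈zs (λ { refl → All.lookup x∉xs x′∈xs (injective Rxz Rx′z′) }) , Rx′z′
    ih : length xs ≤ length zs′
    ih = length-≤-by-injective-relation unique[xs] cover′ injective

∃-prime-divisor : ∀ {v} → 1 < v → ∃[ p ] (Prime p × p ∣ v)
∃-prime-divisor {v@(suc _)} 1<v with factorise v
... | record { factors = [] ; isFactorisation = v≡1 } = contradiction v≡1 (>⇒≢ 1<v)
... | record { factors = p ∷ qs ; isFactorisation = v≡p*Πqs ; factorsPrime = prime[p] ∷ _ } =
  p , prime[p] , subst (p ∣_) (sym v≡p*Πqs) (m∣m*n (product qs))

prime∤⇒coprime : ∀ {p m} → Prime p → ¬ p ∣ m → Coprime p m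
prime∤⇒coprime prime[p] p∤m (d∣p , d∣m) with prime⇒irreducible prime[p] d∣p
... | inj₁ d≡1 = d≡1
... | inj₂ refl = contradiction d∣m p∤m

∣*prime⇒∣⊎prime∣ : ∀ {v m q} → Prime q → v ∣ m * q → v ∣ m ⊎ q ∣ v
∣*prime⇒∣⊎prime∣ {v} {m} {q} prime[q] v∣m*q with q ∣? v
... | yes q∣v = inj₂ q∣v
... | no q∤v = inj₁ (coprime-divisor (Coprime.sym (prime∤⇒coprime prime[q] q∤v))
                                     (subst (v ∣_) (*-comm m q) v∣m*q))

-- Writing n = e u, the hypothesis n ∣ u p cancels to e ∣ p, and e = 1 would make u = n.
∣∧<∧∣*prime⇒*prime≡ : ∀ {n u p} → Prime p → u ∣ n → u < n → n ∣ u * p → u * p ≡ n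
∣∧<∧∣*prime⇒*prime≡ {n} {u} {p} prime[p] (divides e n≡e*u) u<n n∣u*p
  with prime⇒irreducible prime[p] e∣p
  where
  instance
    _ : NonZero u
    _ = ≢-nonZero λ { refl → <-irrefl (sym (trans n≡e*u (*-zeroʳ e))) u<n }
  e∣p : e ∣ p
  e∣p = *-cancelʳ-∣ u (subst₂ _∣_ n≡e*u (*-comm u p) n∣u*p)
... | inj₁ refl = contradiction (sym (trans n≡e*u (*-identityˡ u))) (<⇒≢ u<n)
... | inj₂ refl = trans (*-comm u p) (sym n≡e*u)

dominating-nonempty : ∀ {n v Z} → ProperDivisor n v → Dominating n Z → 0 < length Z
dominating-nonempty {Z = []} v-vertex (_ , dominate) with _ , () , _ ← dominate _ v-vertex (λ ())
dominating-nonempty {Z = _ ∷ _} _ _ = s≤s z≤n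

prime-properDivisor-*prime : ∀ {p q} → Prime p → Prime q → ProperDivisor (p * q) p
prime-properDivisor-*prime {p} {q} prime[p] prime[q] =
  nonTrivial⇒n>1 p {{prime⇒nonTrivial prime[p]}} ,
  m<m*n p q {{prime⇒nonZero prime[p]}} (nonTrivial⇒n>1 q {{prime⇒nonTrivial prime[q]}}) ,
  m∣m*n q

prime-dominates-product : ∀ {p q} → Prime p → Prime q → Dominating (p * q) (p ∷ [])
prime-dominates-product {p} {q} prime[p] prime[q] =
  (([] ∷ []) , prime-properDivisor-*prime prime[p] prime[q] ∷ []) , dominate
  where
  dominate : ∀ v → ProperDivisor (p * q) v → v ∉ p ∷ [] → ∃[ u ] (u ∈ p ∷ [] × Adj (p * q) u v)
  dominate v (1<v , _ , v∣p*q) v∉[p] with ∣*prime⇒∣⊎prime∣ prime[q] v∣p*q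
  ... | inj₂ q∣v = p , here refl , (λ { refl → v∉[p] (here refl) }) , *-monoʳ-∣ p q∣v
  ... | inj₁ v∣p with prime⇒irreducible prime[p] v∣p
  ...   | inj₁ refl = contradiction 1<v (<-irrefl refl)
  ...   | inj₂ refl = contradiction (here refl) v∉[p]

twoDistinctPrimes⇒dominationNumber≡1 : ∀ {n} → TwoDistinctPrimes n → DominationNumber n 1
twoDistinctPrimes⇒dominationNumber≡1 (p , q , prime[p] , prime[q] , _ , refl) =
  ((p ∷ []) , prime-dominates-product prime[p] prime[q] , refl) ,
  λ _ → dominating-nonempty (prime-properDivisor-*prime prime[p] prime[q])

PrimeDivisors : ℕ → List ℕ → Set
PrimeDivisors n ps = ∀ p → p ∈ ps ⇔ (Prime p × p ∣ n)

PrimeCofactors : ℕ → List ℕ → Set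
PrimeCofactors n ys = ∀ y → y ∈ ys ⇔ (∃[ p ] (Prime p × p ∣ n × y * p ≡ n))

Covers : ℕ → ℕ → ℕ → Set
Covers n z p = z ≡ p ⊎ z * p ≡ n

length-cofactors≤length-primeDivisors : ∀ {n ps ys} → Unique ys →
  PrimeDivisors n ps → PrimeCofactors n ys → length ys ≤ length ps
length-cofactors≤length-primeDivisors {n} {ps} {ys} unique[ys] ps-spec ys-spec =
  length-≤-by-injective-relation _≟_ (λ y p → Prime p × y * p ≡ n) unique[ys] cover injective
  where
  cover : ∀ {y} → y ∈ ys → ∃[ p ] (p ∈ ps × (Prime p × y * p ≡ n))
  cover {y} y∈ys with p , prime[p] , p∣n , y*p≡n ← Equivalence.to (ys-spec y) y∈ys =
    p , Equivalence.from (ps-spec p) (prime[p] , p∣n) , prime[p] , y*p≡n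
  injective : ∀ {y y′ p} → Prime p × y * p ≡ n → Prime p × y′ * p ≡ n → y ≡ y′
  injective {y} {y′} {p} (prime[p] , y*p≡n) (_ , y′*p≡n) =
    *-cancelʳ-≡ y y′ p {{prime⇒nonZero prime[p]}} (trans y*p≡n (sym y′*p≡n))

module _ {n : ℕ} .{{_ : NonZero n}} (n-nonprime : ¬ Prime n) where

  prime-properDivisor : ∀ {p} → Prime p → p ∣ n → ProperDivisor n p
  prime-properDivisor {p} prime[p] p∣n =
    nonTrivial⇒n>1 p {{prime⇒nonTrivial prime[p]}} ,
    ≤∧≢⇒< (∣⇒≤ p∣n) (λ { refl → n-nonprime prime[p] }) ,
    p∣n

  cofactor-properDivisor : ∀ {y p} → Prime p → y * p ≡ n → ProperDivisor n y
  cofactor-properDivisor {zero} _ refl = contradiction refl (≢-nonZero⁻¹ n)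
  cofactor-properDivisor {suc zero} {p} prime[p] 1*p≡n =
    contradiction (subst Prime (trans (sym (*-identityˡ p)) 1*p≡n) prime[p]) n-nonprime
  cofactor-properDivisor {y@(suc (suc _))} {p} prime[p] y*p≡n =
    s≤s (s≤s z≤n) ,
    subst (y <_) y*p≡n (m<m*n y p (nonTrivial⇒n>1 p {{prime⇒nonTrivial prime[p]}})) ,
    divides p (trans (sym y*p≡n) (*-comm y p))

  cofactors-dominating : ∀ {ys} → Unique ys → PrimeCofactors n ys → Dominating n ys
  cofactors-dominating {ys} unique[ys] ys-spec = (unique[ys] , All.tabulate vertex) , dominate
    where
    vertex : ∀ {y} → y ∈ ys → ProperDivisor n y
    vertex {y} y∈ys with _ , prime[p] , _ , y*p≡n ← Equivalence.to (ys-spec y) y∈ys =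
      cofactor-properDivisor prime[p] y*p≡n
    dominate : ∀ v → ProperDivisor n v → v ∉ ys → ∃[ u ] (u ∈ ys × Adj n u v)
    dominate v (1<v , _ , v∣n) v∉ys with p , prime[p] , p∣v ← ∃-prime-divisor 1<v =
      q , q∈ys , (λ q≡v → v∉ys (subst (_∈ ys) q≡v q∈ys)) , subst (_∣ q * v) (sym n≡q*p) (*-monoʳ-∣ q p∣v)
      where
      p∣n : p ∣ n
      p∣n = ∣-trans p∣v v∣n
      q : ℕ
      q = quotient p∣n
      n≡q*p : n ≡ q * p
      n≡q*p = m∣n⇒n≡quotient*m p∣n
      q∈ys : q ∈ ys
      q∈ys = Equivalence.from (ys-spec q) (p , prime[p] , p∣n , sym n≡q*p)

  dominating-covers-prime : ∀ {Z p} → Dominating n Z → Prime p → p ∣ n → ∃[ z ] (z ∈ Z × Covers n z p)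
  dominating-covers-prime {Z} {p} ((_ , Z-vertices) , dominate) prime[p] p∣n with p ∈? Z
  ... | yes p∈Z = p , p∈Z , inj₁ refl
  ... | no p∉Z with u , u∈Z , _ , n∣u*p ← dominate p (prime-properDivisor prime[p] p∣n) p∉Z
      with _ , u<n , u∣n ← All.lookup Z-vertices u∈Z =
    u , u∈Z , inj₂ (∣∧<∧∣*prime⇒*prime≡ prime[p] u∣n u<n n∣u*p)

  prime-factors-equal : ¬ TwoDistinctPrimes n → ∀ {p p′} → Prime p → Prime p′ → p * p′ ≡ n → p ≡ p′
  prime-factors-equal ¬pq {p} {p′} prime[p] prime[p′] p*p′≡n with p ≟ p′
  ... | yes p≡p′ = p≡p′
  ... | no p≢p′ = contradiction (p , p′ , prime[p] , prime[p′] , p≢p′ , sym p*p′≡n) ¬pq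

  covers-injective : ¬ TwoDistinctPrimes n → ∀ {z p p′} → Prime p → Prime p′ →
    Covers n z p → Covers n z p′ → p ≡ p′
  covers-injective _ _ _ (inj₁ refl) (inj₁ refl) = refl
  covers-injective ¬pq prime[p] prime[p′] (inj₁ refl) (inj₂ p*p′≡n) =
    prime-factors-equal ¬pq prime[p] prime[p′] p*p′≡n
  covers-injective ¬pq prime[p] prime[p′] (inj₂ p′*p≡n) (inj₁ refl) =
    sym (prime-factors-equal ¬pq prime[p′] prime[p] p′*p≡n)
  covers-injective _ {z} {p} {p′} _ _ (inj₂ z*p≡n) (inj₂ z*p′≡n) =
    *-cancelˡ-≡ p p′ z {{nonZero[z]}} (trans z*p≡n (sym z*p′≡n))
    where
    nonZero[z] : NonZero z
    nonZero[z] = ≢-nonZero λ { refl → ≢-nonZero⁻¹ n (sym z*p≡n) }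

  length-primeDivisors≤length-dominating : ¬ TwoDistinctPrimes n → ∀ {ps Z} → Unique ps →
    PrimeDivisors n ps → Dominating n Z → length ps ≤ length Z
  length-primeDivisors≤length-dominating ¬pq {ps} {Z} unique[ps] ps-spec Z-dominating =
    length-≤-by-injective-relation _≟_ (λ p z → Prime p × Covers n z p) unique[ps] cover injective
    where
    cover : ∀ {p} → p ∈ ps → ∃[ z ] (z ∈ Z × (Prime p × Covers n z p))
    cover {p} p∈ps with prime[p] , p∣n ← Equivalence.to (ps-spec p) p∈ps
                   with z , z∈Z , z-covers-p ← dominating-covers-prime Z-dominating prime[p] p∣n =
      z , z∈Z , prime[p] , z-covers-p
    injective : ∀ {p p′ z} → Prime p × Covers n z p → Prime p′ × Covers n z p′ → p ≡ p′
    injective (prime[p] , z-covers-p) (prime[p′] , z-covers-p′) =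
      covers-injective ¬pq prime[p] prime[p′] z-covers-p z-covers-p′

proposition5p10 : (n : ℕ) → Composite n → ¬ PrimeSquare n →
    (ps : List ℕ) → Unique ps → (∀ p → p ∈ ps ⇔ (Prime p × p ∣ n)) →
    (ys : List ℕ) → Unique ys →
    (∀ y → y ∈ ys ⇔ (∃[ p ] (Prime p × p ∣ n × y * p ≡ n))) →
    (¬ TwoDistinctPrimes n → MinDominating n ys) ×
    (TwoDistinctPrimes n → DominationNumber n 1) ×
    (¬ TwoDistinctPrimes n → DominationNumber n (length ps))
proposition5p10 n composite[n] _ ps unique[ps] ps-spec ys unique[ys] ys-spec =
  (λ ¬pq → ys-dominating , λ Z Z-dominating → ≤-trans |ys|≤|ps| (|ps|≤ ¬pq Z-dominating)) ,
  twoDistinctPrimes⇒dominationNumber≡1 ,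
  (λ ¬pq → (ys , ys-dominating , ≤-antisym |ys|≤|ps| (|ps|≤ ¬pq ys-dominating)) , λ _ → |ps|≤ ¬pq)
  where
  instance
    _ : NonZero n
    _ = composite⇒nonZero composite[n]
  n-nonprime : ¬ Prime n
  n-nonprime = composite⇒¬prime composite[n]
  ys-dominating : Dominating n ys
  ys-dominating = cofactors-dominating n-nonprime unique[ys] ys-spec
  |ys|≤|ps| : length ys ≤ length ps
  |ys|≤|ps| = length-cofactors≤length-primeDivisors unique[ys] ps-spec ys-spec
  |ps|≤ : ¬ TwoDistinctPrimes n → ∀ {Z} → Dominating n Z → length ps ≤ length Z
  |ps|≤ ¬pq = length-primeDivisors≤length-dominating n-nonprime ¬pq unique[ps] ps-spec
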